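{- For every model $M$ of $T$, the graph $G_{tree}(M)$ is a forest.
   Context: Graphs are simple undirected graphs in the language $\{E\}$; subgraphs are induced. A vertex $x$ of a graph $A$ is removable from $A$ if it has at most one neighbour in $A$, or exactly two neighbours in $A$ which are adjacent. $T$ is the theory of graphs stating: (1) every edge is contained in exactly two triangles; (2) every finite subgraph has a removable vertex. In a model $M$ of $T$, each edge $e$ generates a subgraph $F(e)$ isomorphic to the Farey graph (the smallest subgraph containing $e$ which, for each of its edges, contains both triangles of $M$ on that edge); two edges $e,e'$ are equivalent if $F(e)=F(e')$ (equivalently, $e=e'$ or they lie on a common simple cycle). A vertex belongs to an equivalence class if it lies on an edge of that class. $G_{tree}(M)$ is the bipartite graph whose vertex set is the disjoint union of the vertex set of $M$ and the set $\mathcal E$ of equivalence classes of edges of $M$, where a vertex $x$ of $M$ is adjacent to $E\in\mathcal E$ iff $x$ belongs to $E$. -}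

module Defs where

open import Level using (Level; _⊔_)
open import Data.Nat using (ℕ; _+_)
open import Data.Fin using (Fin; zero; suc; inject₁; fromℕ)
open import Data.Product using (Σ; ∃; _×_; _,_)
open import Data.Sum using (_⊎_; inj₁; inj₂)
open import Data.Empty using (⊥)
open import Data.List using (List; [])
open import Data.List.Membership.Propositional using (_∈_)
open import Relation.Binary.PropositionalEquality using (_≡_)
open import Relation.Nullary using (¬_)

record Graph (ℓ : Level) : Set (Level.suc ℓ) where
  field
    V      : Set ℓ
    E      : V → V → Set ℓ
    E-sym  : ∀ {x y} → E x y → E y x
    E-irr  : ∀ {x} → ¬ E x x
open Graph public

module _ {ℓ : Level} (M : Graph ℓ) where

  Removable : List (V M) → V M → Set ℓ
  Removable A x =
      (∀ y z → y ∈ A → z ∈ A → E M x y → E M x z → y ≡ z)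
    ⊎ (Σ (V M) λ y → Σ (V M) λ z →
         y ∈ A × z ∈ A × ¬ (y ≡ z) × E M x y × E M x z × E M y z ×
         (∀ w → w ∈ A → E M x w → (w ≡ y) ⊎ (w ≡ z)))

  Axiom1 : Set ℓ
  Axiom1 = ∀ x y → E M x y →
    Σ (V M) λ z₁ → Σ (V M) λ z₂ →
      ¬ (z₁ ≡ z₂) × E M x z₁ × E M y z₁ × E M x z₂ × E M y z₂ ×
      (∀ z → E M x z → E M y z → (z ≡ z₁) ⊎ (z ≡ z₂))

  Axiom2 : Set ℓ
  Axiom2 = ∀ (A : List (V M)) → ¬ (A ≡ []) →
    Σ (V M) λ x → x ∈ A × Removable A x

  ModelOfT : Set ℓ
  ModelOfT = Axiom1 × Axiom2

  -- (oriented) edges of M; {x,y} is represented by (x , y , _) or (y , x , _)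
  Edge : Set ℓ
  Edge = Σ (V M) λ x → Σ (V M) λ y → E M x y

  -- vertex set of F(e): the smallest vertex set containing the endpoints
  -- of e such that the induced subgraph contains, for each of its edges,
  -- both triangles of M on that edge
  data InF (e : Edge) : V M → Set ℓ where
    base₁ : ∀ {x y p} → e ≡ (x , y , p) → InF e x
    base₂ : ∀ {x y p} → e ≡ (x , y , p) → InF e y
    step  : ∀ {x y z} → InF e x → InF e y → E M x y → E M x z → E M y z →
            InF e z

  -- e ~ e'  iff  F(e) = F(e')   (F(e) is induced, so equal vertex sets)
  EdgeEquiv : Edge → Edge → Set ℓ
  EdgeEquiv e e' = ∀ v → (InF e v → InF e' v) × (InF e' v → InF e v)

  Belongs : V M → Edge → Set ℓ
  Belongs x e = Σ Edge λ e' → EdgeEquiv e e' ×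
    (Σ (V M) λ y → Σ (E M x y) λ p → e' ≡ (x , y , p))

-- Graphs whose vertices are given up to an equivalence (a setoid), so that
-- equivalence classes of edges can be represented by representatives.

record SetoidGraph (ℓ : Level) : Set (Level.suc ℓ) where
  field
    Vert : Set ℓ
    _≈_  : Vert → Vert → Set ℓ
    Adj  : Vert → Vert → Set ℓ
open SetoidGraph public

Cycle : ∀ {ℓ} → SetoidGraph ℓ → Set ℓ
Cycle G = Σ ℕ λ k → Σ (Fin (3 + k) → Vert G) λ c →
    (∀ i j → _≈_ G (c i) (c j) → i ≡ j)
  × (∀ (i : Fin (2 + k)) → Adj G (c (inject₁ i)) (c (suc i)))
  × Adj G (c (fromℕ (2 + k))) (c zero)

Forest : ∀ {ℓ} → SetoidGraph ℓ → Set ℓ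
Forest G = ¬ Cycle G

Gtree : ∀ {ℓ} (M : Graph ℓ) → SetoidGraph ℓ
Gtree {ℓ} M = record { Vert = V M ⊎ Edge M ; _≈_ = eq ; Adj = adj }
  where
  open import Data.Empty.Polymorphic using () renaming (⊥ to ⊥ℓ)
  eq : V M ⊎ Edge M → V M ⊎ Edge M → Set ℓ
  eq (inj₁ x) (inj₁ y) = x ≡ y
  eq (inj₂ e) (inj₂ e') = EdgeEquiv M e e'
  eq _ _ = ⊥ℓ
  adj : V M ⊎ Edge M → V M ⊎ Edge M → Set ℓ
  adj (inj₁ x) (inj₂ e) = Belongs M x e
  adj (inj₂ e) (inj₁ x) = Belongs M x e
  adj _ _ = ⊥ℓ

-- Only axiom (2) is used.  Close a path w by an edge c into a simple cycle.  A removable vertex of the cycle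
-- has its two cycle-neighbours adjacent; this chord forms a triangle with the two cycle edges at the vertex,
-- so all three are equivalent, and it cuts off a shorter cycle.  By induction all edges of a simple cycle are
-- equivalent.  Hence F(f) is connected by edges of the class of f, and a path leaving F(f) through an edge
-- outside the class never returns to F(f): closing it up by a path inside the class would give a simple cycle
-- meeting two classes.  A cycle of G_tree through a class E yields such a path between two distinct vertices
-- of E, glued together from paths inside the other classes on the cycle.
-- Vertex equality is not decidable, so walks are shortened to paths only under double negation, which is
-- harmless as the goal is ⊥.
module Submission where

open import Defs
open import Level using (Level; _⊔_; lift)
open import Function using (_∘_; id)
open import Data.Nat using (ℕ; zero; suc; _+_; _≤_; s≤s)
open import Data.Nat.Properties using (≤-refl; ≤-pred)
open import Data.Fin using (Fin; zero; suc; inject₁; fromℕ)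
open import Data.Product using (Σ-syntax; _×_; _,_; proj₁; proj₂)
open import Data.Sum using (inj₁; inj₂)
open import Data.Empty using (⊥; ⊥-elim)
open import Data.List using (List; []; _∷_; _++_)
open import Data.List.Relation.Unary.Any using (here; there)
import Data.List.Relation.Unary.All as All
import Data.List.Relation.Unary.All.Properties as All
open import Data.List.Relation.Unary.Unique.Propositional using (Unique; []; _∷_)
import Data.List.Relation.Unary.Unique.Propositional.Properties as Unique
open import Data.List.Relation.Binary.Disjoint.Propositional using (Disjoint)
open import Data.List.Relation.Binary.Subset.Propositional using (_⊆_)
open import Data.List.Relation.Binary.Subset.Propositional.Properties using (⊆-trans; ∷⁺ʳ)
open import Data.List.Membership.Propositional using (_∈_)
open import Relation.Binary.Core using (Rel)
open import Relation.Binary.Construct.Closure.ReflexiveTransitive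
  using (Star; ε; _◅_; _◅◅_; map; reverse; return)
open import Relation.Binary.PropositionalEquality using (_≡_; _≢_; refl; sym; trans; cong; subst)
open import Relation.Nullary using (¬_; Dec; yes; no)
open import Relation.Nullary.Negation using (¬¬-Monad; contradiction)
open import Relation.Nullary.Decidable using (¬¬-excluded-middle)
open import Relation.Unary using (Pred; _≐_)
open import Relation.Unary.Properties using (≐-refl; ≐-sym; ≐-trans)
open import Effect.Monad using (RawMonad)

module _ {a} {A : Set a} where

  Unique-++⁻ : (xs : List A) {ys : List A} → Unique (xs ++ ys) → Unique xs × Unique ys × Disjoint xs ys
  Unique-++⁻ [] u = [] , u , λ ()
  Unique-++⁻ (x ∷ xs) (x∉ ∷ u) with Unique-++⁻ xs u
  ... | xs-unique , ys-unique , disjoint = All.++⁻ˡ xs x∉ ∷ xs-unique , ys-unique , λ where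
    (here refl , v∈ys) → All.lookup (All.++⁻ʳ xs x∉) v∈ys refl
    (there v∈xs , v∈ys) → disjoint (v∈xs , v∈ys)

  Unique-remove : (xs : List A) {y : A} {ys : List A} → Unique (xs ++ y ∷ ys) → Unique (xs ++ ys)
  Unique-remove xs u with Unique-++⁻ xs u
  ... | xs-unique , _ ∷ ys-unique , disjoint =
    Unique.++⁺ xs-unique ys-unique λ (v∈xs , v∈ys) → disjoint (v∈xs , there v∈ys)

module _ {a t} {A : Set a} {T : Rel A t} where

  targets : ∀ {x y} → Star T x y → List A
  targets ε = []
  targets (_◅_ {j = v} _ w) = v ∷ targets w

  vertices : ∀ {x y} → Star T x y → List A
  vertices {x} w = x ∷ targets w

  length : ∀ {x y} → Star T x y → ℕ
  length ε = zero
  length (_ ◅ w) = suc (length w)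

  end∈vertices : ∀ {x y} (w : Star T x y) → y ∈ vertices w
  end∈vertices ε = here refl
  end∈vertices (_ ◅ w) = there (end∈vertices w)

  vertices-◅◅ : ∀ {x y z} (w₁ : Star T x y) (w₂ : Star T y z) →
                vertices (w₁ ◅◅ w₂) ≡ vertices w₁ ++ targets w₂
  vertices-◅◅ ε w₂ = refl
  vertices-◅◅ {x} (_ ◅ w₁) w₂ = cong (x ∷_) (vertices-◅◅ w₁ w₂)

  vertices-◅◅ˡ : ∀ {x y z} (w₁ : Star T x y) {w₂ : Star T y z} → vertices w₁ ⊆ vertices (w₁ ◅◅ w₂)
  vertices-◅◅ˡ ε (here refl) = here refl
  vertices-◅◅ˡ (_ ◅ w₁) (here refl) = here refl
  vertices-◅◅ˡ (_ ◅ w₁) (there v∈) = there (vertices-◅◅ˡ w₁ v∈)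

  vertices-◅◅ʳ : ∀ {x y z} (w₁ : Star T x y) {w₂ : Star T y z} → vertices w₂ ⊆ vertices (w₁ ◅◅ w₂)
  vertices-◅◅ʳ ε = id
  vertices-◅◅ʳ (_ ◅ w₁) = there ∘ vertices-◅◅ʳ w₁

  Unique-◅◅⁻ : ∀ {x y z} (w₁ : Star T x y) {w₂ : Star T y z} → Unique (vertices (w₁ ◅◅ w₂)) →
               Unique (vertices w₁) × Unique (targets w₂) × Disjoint (vertices w₁) (targets w₂)
  Unique-◅◅⁻ w₁ {w₂} = Unique-++⁻ (vertices w₁) ∘ subst Unique (vertices-◅◅ w₁ w₂)

  Unique-◅◅⁻ʳ : ∀ {x y z} (w₁ : Star T x y) {w₂ : Star T y z} →
                Unique (vertices (w₁ ◅◅ w₂)) → Unique (vertices w₂)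
  Unique-◅◅⁻ʳ ε = id
  Unique-◅◅⁻ʳ (_ ◅ w₁) (_ ∷ u) = Unique-◅◅⁻ʳ w₁ u

  length-◅◅-return : ∀ {x y z} (w : Star T x y) (e : T y z) → length (w ◅◅ return e) ≡ suc (length w)
  length-◅◅-return ε e = refl
  length-◅◅-return (_ ◅ w) e = cong suc (length-◅◅-return w e)

  length-shortcut : ∀ {x u z v y} (w₁ : Star T x u) {e₁ : T u z} {e₂ : T z v} (e : T u v) (w₂ : Star T v y) →
                    length (w₁ ◅◅ e₁ ◅ e₂ ◅ w₂) ≡ suc (length (w₁ ◅◅ e ◅ w₂))
  length-shortcut ε e w₂ = refl
  length-shortcut (_ ◅ w₁) e w₂ = cong suc (length-shortcut w₁ e w₂)

  Unique-shortcut : ∀ {x u z v y} (w₁ : Star T x u) {e₁ : T u z} {e₂ : T z v} (e : T u v) (w₂ : Star T v y) →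
                    Unique (vertices (w₁ ◅◅ e₁ ◅ e₂ ◅ w₂)) → Unique (vertices (w₁ ◅◅ e ◅ w₂))
  Unique-shortcut w₁ e w₂ =
    subst Unique (sym (vertices-◅◅ w₁ (e ◅ w₂))) ∘ Unique-remove (vertices w₁) ∘ subst Unique (vertices-◅◅ w₁ _)

  data TargetView {x y} : A → Star T x y → Set (a ⊔ t) where
    last  : ∀ {u} (w : Star T x u) (e : T u y) → TargetView y (w ◅◅ return e)
    inner : ∀ {u z v} (w₁ : Star T x u) (e₁ : T u z) (e₂ : T z v) (w₂ : Star T v y) →
            TargetView z (w₁ ◅◅ e₁ ◅ e₂ ◅ w₂)

  target-view : ∀ {x y z} (w : Star T x y) → z ∈ targets w → TargetView z w
  target-view (e ◅ ε) (here refl) = last ε e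
  target-view (e₁ ◅ e₂ ◅ w) (here refl) = inner ε e₁ e₂ w
  target-view (e ◅ w) (there z∈) with target-view w z∈
  ... | last w₁ e′ = last (e ◅ w₁) e′
  ... | inner w₁ e₁ e₂ w₂ = inner (e ◅ w₁) e₁ e₂ w₂

  split-at : ∀ {x y z} (w : Star T x y) → z ∈ vertices w →
             Σ[ w₁ ∈ Star T x z ] Σ[ w₂ ∈ Star T z y ] w ≡ w₁ ◅◅ w₂
  split-at w (here refl) = ε , w , refl
  split-at (e ◅ w) (there z∈) with split-at w z∈
  ... | w₁ , w₂ , refl = e ◅ w₁ , w₂ , refl

  Simplification : ∀ {x y} → Star T x y → Set (a ⊔ t)
  Simplification {x} {y} w = Σ[ w′ ∈ Star T x y ] Unique (vertices w′) × vertices w′ ⊆ vertices w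

  cons-or-cut : ∀ {x y z} (e : T x y) (w : Star T y z) → Unique (vertices w) → Dec (x ∈ vertices w) →
                Simplification (e ◅ w)
  cons-or-cut e w w-simple (no x∉w) = e ◅ w , All.¬Any⇒All¬ _ x∉w ∷ w-simple , id
  cons-or-cut e w w-simple (yes x∈w) with split-at w x∈w
  ... | w₁ , w₂ , refl = w₂ , Unique-◅◅⁻ʳ w₁ w-simple , there ∘ vertices-◅◅ʳ w₁

  simplify : ∀ {x y} (w : Star T x y) → ¬ ¬ Simplification w
  simplify ε k = k (ε , All.[] ∷ [] , id)
  simplify {x} (e ◅ w) k =
    simplify w λ (w′ , w′-simple , w′⊆w) → ¬¬-excluded-middle λ x∈w′? →
    let (w″ , w″-simple , w″⊆) = cons-or-cut e w′ w′-simple x∈w′? in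
    k (w″ , w″-simple , ⊆-trans w″⊆ (∷⁺ʳ x w′⊆w))

  module _ {s} (S : Pred A s) where

    data FirstEntry {x y} : Star T x y → Set (a ⊔ t ⊔ s) where
      entry : ∀ {z} (w₁ : Star T x z) (w₂ : Star T z y) → S z → (∀ {v} → v ∈ vertices w₁ → S v → v ≡ z) →
              FirstEntry (w₁ ◅◅ w₂)

    entry-◅ : ∀ {x y z} {w : Star T y z} (e : T x y) → ¬ S x → FirstEntry w → FirstEntry (e ◅ w)
    entry-◅ e ¬Sx (entry w₁ w₂ Sz first) = entry (e ◅ w₁) w₂ Sz λ where
      (here refl) Sv → contradiction Sv ¬Sx
      (there v∈) Sv → first v∈ Sv

    first-entry : ∀ {x y} (w : Star T x y) → S y → ¬ ¬ FirstEntry w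
    first-entry-from : ∀ {x y} → Dec (S x) → (w : Star T x y) → S y → ¬ ¬ FirstEntry w
    first-entry w Sy k = ¬¬-excluded-middle λ Sx? → first-entry-from Sx? w Sy k
    first-entry-from (yes Sx) w Sy k = k (entry ε w Sx λ { (here refl) _ → refl })
    first-entry-from (no ¬Sx) ε Sx = contradiction Sx ¬Sx
    first-entry-from (no ¬Sx) (e ◅ w) Sy k = first-entry w Sy (k ∘ entry-◅ e ¬Sx)

  data AllEdges {p} (P : ∀ {x y} → T x y → Set p) : ∀ {x y} → Star T x y → Set (a ⊔ t ⊔ p) where
    ε   : ∀ {x} → AllEdges P (ε {x = x})
    _◅_ : ∀ {x y z} {e : T x y} {w : Star T y z} → P e → AllEdges P w → AllEdges P (e ◅ w)

  module _ {p} {P : ∀ {x y} → T x y → Set p} where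

    AllEdges-map : ∀ {q} {Q : ∀ {x y} → T x y → Set q} → (∀ {x y} {e : T x y} → P e → Q e) →
                   ∀ {x y} {w : Star T x y} → AllEdges P w → AllEdges Q w
    AllEdges-map f ε = ε
    AllEdges-map f (pe ◅ A) = f pe ◅ AllEdges-map f A

    AllEdges-◅◅ : ∀ {x y z} {w₁ : Star T x y} {w₂ : Star T y z} →
                  AllEdges P w₁ → AllEdges P w₂ → AllEdges P (w₁ ◅◅ w₂)
    AllEdges-◅◅ ε A₂ = A₂
    AllEdges-◅◅ (pe ◅ A₁) A₂ = pe ◅ AllEdges-◅◅ A₁ A₂

    AllEdges-head : ∀ {x y z} {e : T x y} {w : Star T y z} → AllEdges P (e ◅ w) → P e
    AllEdges-head (pe ◅ _) = pe

    AllEdges-detour : ∀ {x u z v y} (w₁ : Star T x u) {e : T u v} {e₁ : T u z} {e₂ : T z v} {w₂ : Star T v y} →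
                      (P e → P e₁) → (P e → P e₂) →
                      AllEdges P (w₁ ◅◅ e ◅ w₂) → AllEdges P (w₁ ◅◅ e₁ ◅ e₂ ◅ w₂)
    AllEdges-detour ε f₁ f₂ (pe ◅ A) = f₁ pe ◅ f₂ pe ◅ A
    AllEdges-detour (_ ◅ w₁) f₁ f₂ (pe ◅ A) = pe ◅ AllEdges-detour w₁ f₁ f₂ A

    AllEdges-◅◅⁻ : ∀ {x y z} (w₁ : Star T x y) {w₂ : Star T y z} →
                   AllEdges P (w₁ ◅◅ w₂) → AllEdges P w₁ × AllEdges P w₂
    AllEdges-◅◅⁻ ε A = ε , A
    AllEdges-◅◅⁻ (_ ◅ w₁) (pe ◅ A) with AllEdges-◅◅⁻ w₁ A
    ... | A₁ , A₂ = pe ◅ A₁ , A₂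

  path-along : ∀ {n} (g : Fin (suc n) → A) → (∀ i → T (g (inject₁ i)) (g (suc i))) →
               Star T (g zero) (g (fromℕ n))
  path-along {zero} g link = ε
  path-along {suc n} g link = link zero ◅ path-along (g ∘ suc) (link ∘ suc)

module _ {a t u} {A : Set a} {T : Rel A t} {U : Rel A u} where

  targets-map : (f : ∀ {x y} → T x y → U x y) → ∀ {x y} (w : Star T x y) →
                targets (map f w) ≡ targets w
  targets-map f ε = refl
  targets-map f (_◅_ {j = v} _ w) = cong (v ∷_) (targets-map f w)

module Model {ℓ} (M : Graph ℓ) where

  open RawMonad (¬¬-Monad {ℓ}) using (_>>=_; pure)

  Walk : Rel (V M) ℓ
  Walk = Star (E M)

  removable-chord : ∀ {A z u v} → Removable M A z → u ∈ A → v ∈ A → E M z u → E M z v → u ≢ v → E M u v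
  removable-chord (inj₁ one-neighbour) u∈ v∈ zu zv u≢v = contradiction (one-neighbour _ _ u∈ v∈ zu zv) u≢v
  removable-chord (inj₂ (_ , _ , _ , _ , _ , _ , _ , yy′ , only)) u∈ v∈ zu zv u≢v
    with only _ u∈ zu | only _ v∈ zv
  ... | inj₁ refl | inj₁ refl = contradiction refl u≢v
  ... | inj₁ refl | inj₂ refl = yy′
  ... | inj₂ refl | inj₁ refl = E-sym M yy′
  ... | inj₂ refl | inj₂ refl = contradiction refl u≢v

  edge : ∀ {x y} → E M x y → Edge M
  edge {x} {y} p = x , y , p

  F : ∀ {x y} → E M x y → Pred (V M) ℓ
  F p = InF M (edge p)

  infix 4 _∼_
  _∼_ : ∀ {x y u v} → E M x y → E M u v → Set ℓ
  p ∼ q = F p ≐ F q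

  F-⊆ : ∀ {x y u v} {p : E M x y} {q : E M u v} → F q x → F q y → ∀ {z} → F p z → F q z
  F-⊆ x∈ y∈ (base₁ refl) = x∈
  F-⊆ x∈ y∈ (base₂ refl) = y∈
  F-⊆ x∈ y∈ (step i j xy xz yz) = step (F-⊆ x∈ y∈ i) (F-⊆ x∈ y∈ j) xy xz yz

  ∼-parallel : ∀ {x y} (p q : E M x y) → p ∼ q
  ∼-parallel p q = F-⊆ (base₁ refl) (base₂ refl) , F-⊆ (base₁ refl) (base₂ refl)

  ∼-flip : ∀ {x y} (p : E M x y) → p ∼ E-sym M p
  ∼-flip p = F-⊆ (base₂ refl) (base₁ refl) , F-⊆ (base₂ refl) (base₁ refl)

  triangleˡ : ∀ {x u v} (p : E M x u) (q : E M x v) → E M u v → p ∼ q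
  triangleˡ p q r = F-⊆ (base₁ refl) (step (base₁ refl) (base₂ refl) q p (E-sym M r))
                  , F-⊆ (base₁ refl) (step (base₁ refl) (base₂ refl) p q r)

  triangleʳ : ∀ {u v x} (p : E M u x) (q : E M v x) → E M v u → p ∼ q
  triangleʳ p q r = F-⊆ (step (base₁ refl) (base₂ refl) q r (E-sym M p)) (base₂ refl)
                  , F-⊆ (step (base₁ refl) (base₂ refl) p (E-sym M r) (E-sym M q)) (base₂ refl)

  -- A simple cycle is a path w from x to y closed up by an edge c : E M x y.
  CyclesInOneClass : ℕ → Set ℓ
  CyclesInOneClass n = ∀ {x y} (w : Walk x y) → length w ≤ n → Unique (vertices w) →
                       (c : E M x y) → AllEdges (_∼ c) w

  removable-at-start : ∀ {n x y} → CyclesInOneClass n → (w : Walk x y) → length w ≤ suc n →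
                       Unique (vertices w) → (c : E M x y) → Removable M (vertices w) x → AllEdges (_∼ c) w
  removable-at-start ih ε _ _ c _ = ⊥-elim (E-irr M c)
  removable-at-start ih (p ◅ ε) _ _ c _ = ∼-parallel p c ◅ ε
  removable-at-start ih (p ◅ w@(_ ◅ w′)) (s≤s len) (_ ∷ w-simple) c x-removable =
    triangleˡ p c chord ◅ AllEdges-map (λ e∼chord → ≐-trans e∼chord (triangleʳ chord c p)) (ih w len w-simple chord)
    where
    chord = removable-chord x-removable (there (here refl)) (there (end∈vertices w)) p c
              λ { refl → Unique.Unique[x∷xs]⇒x∉xs w-simple (end∈vertices w′) }

  removable-at-end : ∀ {n x t y} → CyclesInOneClass n → (w : Walk x t) (p : E M t y) →
                     length (w ◅◅ return p) ≤ suc n → Unique (vertices (w ◅◅ return p)) → (c : E M x y) →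
                     Removable M (vertices (w ◅◅ return p)) y → AllEdges (_∼ c) (w ◅◅ return p)
  removable-at-end ih ε p _ _ c _ = ∼-parallel p c ◅ ε
  removable-at-end {n} ih w@(_ ◅ w′) p len w-simple c y-removable =
    AllEdges-◅◅ (AllEdges-map (λ e∼chord → ≐-trans e∼chord (triangleˡ chord c p)) (ih w shorter w-simple′ chord))
                (triangleʳ p c chord ◅ ε)
    where
    w-simple′ = proj₁ (Unique-◅◅⁻ w w-simple)
    shorter = ≤-pred (subst (_≤ suc n) (length-◅◅-return w p) len)
    chord = removable-chord y-removable (here refl) (vertices-◅◅ˡ w (end∈vertices w)) (E-sym M c) (E-sym M p)
              λ { refl → Unique.Unique[x∷xs]⇒x∉xs w-simple′ (end∈vertices w′) }

  removable-inside : ∀ {n x t z v y} → CyclesInOneClass n →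
                     (w₁ : Walk x t) (p : E M t z) (q : E M z v) (w₂ : Walk v y) →
                     length (w₁ ◅◅ p ◅ q ◅ w₂) ≤ suc n → Unique (vertices (w₁ ◅◅ p ◅ q ◅ w₂)) → (c : E M x y) →
                     Removable M (vertices (w₁ ◅◅ p ◅ q ◅ w₂)) z → AllEdges (_∼ c) (w₁ ◅◅ p ◅ q ◅ w₂)
  removable-inside {n} ih w₁ p q w₂ len w-simple c z-removable =
    AllEdges-detour w₁ (≐-trans (triangleˡ p chord q)) (≐-trans (triangleʳ q chord p))
      (ih (w₁ ◅◅ chord ◅ w₂) shorter (Unique-shortcut w₁ chord w₂ w-simple) c)
    where
    chord = removable-chord z-removable (vertices-◅◅ˡ w₁ (end∈vertices w₁))
              (vertices-◅◅ʳ w₁ (there (there (here refl)))) (E-sym M p) q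
              λ { refl → proj₂ (proj₂ (Unique-◅◅⁻ w₁ w-simple)) (end∈vertices w₁ , there (here refl)) }
    shorter = ≤-pred (subst (_≤ suc n) (length-shortcut w₁ chord w₂) len)

  ClassEdge : ∀ {a b} → E M a b → Rel (V M) ℓ
  ClassEdge f u v = Σ[ p ∈ E M u v ] p ∼ f

  OtherEdge : ∀ {a b} → E M a b → Rel (V M) ℓ
  OtherEdge f u v = Σ[ p ∈ E M u v ] ¬ p ∼ f

  ClassEdge-sym : ∀ {a b u v} {f : E M a b} → ClassEdge f u v → ClassEdge f v u
  ClassEdge-sym (p , p∼f) = E-sym M p , ≐-trans (≐-sym (∼-flip p)) p∼f

  class-walk-⊆F : ∀ {a b x y} {f : E M a b} → F f x → (w : Star (ClassEdge f) x y) →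
                  ∀ {v} → v ∈ vertices w → F f v
  class-walk-⊆F x∈ w (here refl) = x∈
  class-walk-⊆F _ ((_ , p∼f) ◅ w) (there v∈) = class-walk-⊆F (proj₁ p∼f (base₂ refl)) w v∈

  module _ (removable : Axiom2 M) where

    cycles-in-one-class : ∀ n → CyclesInOneClass n
    cycles-in-one-class n ε _ _ c = ⊥-elim (E-irr M c)
    cycles-in-one-class zero (_ ◅ _) () _ _
    cycles-in-one-class (suc n) w len w-simple c with removable (vertices w) (λ ())
    ... | _ , here refl , rem = removable-at-start (cycles-in-one-class n) w len w-simple c rem
    ... | _ , there z∈ , rem with target-view w z∈
    ...   | last w₁ p = removable-at-end (cycles-in-one-class n) w₁ p len w-simple c rem
    ...   | inner w₁ p q w₂ = removable-inside (cycles-in-one-class n) w₁ p q w₂ len w-simple c rem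

    cycle-edges-equivalent : ∀ {x y} (w : Walk x y) → Unique (vertices w) → (c : E M x y) → AllEdges (_∼ c) w
    cycle-edges-equivalent w = cycles-in-one-class (length w) w ≤-refl

    closing-edge-in-class-of-path :
      ∀ {a b x s r} {f : E M a b} (e : E M x s) (Y : Walk s r) (P : Star (ClassEdge f) r x) →
      Unique (x ∷ vertices Y) → Unique (vertices P) →
      (∀ {v} → v ∈ vertices Y → v ∈ vertices P → v ≡ r) → e ∼ f
    closing-edge-in-class-of-path e Y ε (x∉Y ∷ _) _ _ = contradiction (end∈vertices Y) (All.All¬⇒¬Any x∉Y)
    closing-edge-in-class-of-path e Y P@((q , q∼f) ◅ _) (_ ∷ Y-simple) (r∉P ∷ P-simple) meet-at-r =
      ≐-trans (∼-flip e) (≐-trans (≐-sym q∼e) q∼f)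
      where
      cycle = Y ◅◅ map proj₁ P
      cycle-simple : Unique (vertices cycle)
      cycle-simple = subst Unique (sym (trans (vertices-◅◅ Y _) (cong (vertices Y ++_) (targets-map proj₁ P))))
        (Unique.++⁺ Y-simple P-simple λ (v∈Y , v∈P) → All.lookup r∉P v∈P (sym (meet-at-r v∈Y (there v∈P))))
      q∼e = AllEdges-head (proj₂ (AllEdges-◅◅⁻ Y (cycle-edges-equivalent cycle cycle-simple (E-sym M e))))

    closing-edge-in-class : ∀ {a b x s r} {f : E M a b} (e : E M x s) (Y : Walk s r) (P : Star (ClassEdge f) r x) →
                            Unique (x ∷ vertices Y) → (∀ {v} → v ∈ vertices Y → v ∈ vertices P → v ≡ r) →
                            ¬ ¬ (e ∼ f)
    closing-edge-in-class e Y P Y-simple meet-at-r = do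
      (P′ , P′-simple , P′⊆P) ← simplify P
      pure (closing-edge-in-class-of-path e Y P′ Y-simple P′-simple λ v∈Y v∈P′ → meet-at-r v∈Y (P′⊆P v∈P′))

    class-walk-closing-edge : ∀ {a b x y} {f : E M a b} → Star (ClassEdge f) y x → (e : E M x y) → ¬ ¬ (e ∼ f)
    class-walk-closing-edge P e =
      closing-edge-in-class e ε P ((x≢y All.∷ All.[]) ∷ All.[] ∷ []) λ { (here refl) _ → refl }
      where
      x≢y : _
      x≢y refl = E-irr M e

    F⇒class-walk : ∀ {a b v} (f : E M a b) → F f v → ¬ ¬ Star (ClassEdge f) a v
    F⇒class-walk f (base₁ refl) = pure ε
    F⇒class-walk f (base₂ refl) = pure (return (f , ≐-refl))
    F⇒class-walk f (step x∈ y∈ xy xz yz) = do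
      to-x ← F⇒class-walk f x∈
      to-y ← F⇒class-walk f y∈
      xy∼f ← class-walk-closing-edge (reverse ClassEdge-sym to-y ◅◅ to-x) xy
      pure (to-x ◅◅ return (xz , ≐-trans (≐-sym (triangleˡ xy xz yz)) xy∼f))

    class-walk-between : ∀ {a b x y} {f : E M a b} → F f x → F f y → ¬ ¬ Star (ClassEdge f) x y
    class-walk-between {f = f} x∈ y∈ = do
      to-x ← F⇒class-walk f x∈
      to-y ← F⇒class-walk f y∈
      pure (reverse ClassEdge-sym to-x ◅◅ to-y)

    no-reentry : ∀ {a b x s y} {f : E M a b} → F f x → (e : OtherEdge f x s) {Y : Star (OtherEdge f) s y} →
                 Unique (vertices (e ◅ Y)) → ¬ FirstEntry (F f) Y
    no-reentry {x = x} {f = f} x∈ (e , e≁f) Y-simple (entry {z = r} Y₁ _ r∈ first) =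
      class-walk-between r∈ x∈ λ P → closing-edge-in-class e (map proj₁ Y₁) P Y₁-simple (meet-at-r P) e≁f
      where
      Y₁-vertices : vertices (map proj₁ Y₁) ≡ vertices Y₁
      Y₁-vertices = cong (_ ∷_) (targets-map proj₁ Y₁)
      Y₁-simple : Unique (x ∷ vertices (map proj₁ Y₁))
      Y₁-simple = subst (Unique ∘ (x ∷_)) (sym Y₁-vertices) (proj₁ (Unique-◅◅⁻ ((e , e≁f) ◅ Y₁) Y-simple))
      meet-at-r : (P : Star (ClassEdge f) r x) → ∀ {v} → v ∈ vertices (map proj₁ Y₁) → v ∈ vertices P → v ≡ r
      meet-at-r P {v} v∈Y₁ v∈P = first (subst (v ∈_) Y₁-vertices v∈Y₁) (class-walk-⊆F r∈ P v∈P)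

    other-path-trivial : ∀ {a b x y} {f : E M a b} → F f x → F f y →
                         (Q : Star (OtherEdge f) x y) → Unique (vertices Q) → x ≡ y
    other-path-trivial x∈ y∈ ε _ = refl
    other-path-trivial {f = f} x∈ y∈ (e ◅ Q) Q-simple =
      ⊥-elim (first-entry (F f) Q y∈ (no-reentry x∈ e Q-simple))

    F-separated : ∀ {a b x y} {f : E M a b} → F f x → F f y → x ≢ y → ¬ Star (OtherEdge f) x y
    F-separated x∈ y∈ x≢y Q = simplify Q λ (Q′ , Q′-simple , _) → x≢y (other-path-trivial x∈ y∈ Q′ Q′-simple)

  Avoiding : Vert (Gtree M) → Rel (Vert (Gtree M)) ℓ
  Avoiding x₀ u v = Adj (Gtree M) u v × ¬ _≈_ (Gtree M) v x₀

  vertices-not-adjacent : ∀ {u v x y} → u ≡ inj₁ x → v ≡ inj₁ y → ¬ Adj (Gtree M) u v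
  vertices-not-adjacent refl refl (lift ())

  belongs⇒F : ∀ {a b x} {f : E M a b} → Belongs M x (edge f) → F f x
  belongs⇒F (_ , f≃e , _ , _ , refl) = proj₂ (f≃e _) (base₁ refl)

  ∼⇒EdgeEquiv : ∀ {a b c d} {e : E M a b} {f : E M c d} → e ∼ f → EdgeEquiv M (edge e) (edge f)
  ∼⇒EdgeEquiv e∼f _ = proj₁ e∼f , proj₂ e∼f

  leave-class : ∀ {a b c d} {e : E M a b} {f : E M c d} → ¬ EdgeEquiv M (edge e) (edge f) →
                ∀ {u v} → ClassEdge e u v → OtherEdge f u v
  leave-class e≉f (p , p∼e) = p , λ p∼f → e≉f (∼⇒EdgeEquiv (≐-trans (≐-sym p∼e) p∼f))

  module _ (removable : Axiom2 M) where

    tree-walk⇒other-walk : ∀ {a b x y} (f : E M a b) → Star (Avoiding (inj₂ (edge f))) (inj₁ x) (inj₁ y) →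
                           ¬ ¬ Star (OtherEdge f) x y
    tree-walk⇒other-walk f ε = pure ε
    tree-walk⇒other-walk f (_◅_ {j = inj₁ _} (lift () , _) _)
    tree-walk⇒other-walk f (_◅_ {j = inj₂ _} _ (_◅_ {j = inj₂ _} (lift () , _) _))
    tree-walk⇒other-walk f (_◅_ {j = inj₂ (_ , _ , e)} (x∈e , e≉f) (_◅_ {j = inj₁ _} (y∈e , _) W)) = do
      inside ← class-walk-between removable (belongs⇒F x∈e) (belongs⇒F y∈e)
      rest ← tree-walk⇒other-walk f W
      pure (map (leave-class e≉f) inside ◅◅ rest)

    no-detour : ∀ {x₀ u w} {E₀ : Edge M} → x₀ ≡ inj₂ E₀ → Adj (Gtree M) x₀ u → Adj (Gtree M) w x₀ →
                ¬ _≈_ (Gtree M) u w → ¬ Star (Avoiding x₀) u w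
    no-detour {u = inj₂ _} refl (lift ()) _ _ _
    no-detour {u = inj₁ _} {w = inj₂ _} refl _ (lift ()) _ _
    no-detour {u = inj₁ _} {w = inj₁ _} {E₀ = _ , _ , f} refl x∈ y∈ x≢y W =
      tree-walk⇒other-walk f W (F-separated removable (belongs⇒F x∈) (belongs⇒F y∈) x≢y)

-- The cycle alternates between vertices and classes, so c 0 or c 1 is a class E₀; its two neighbours on the
-- cycle are distinct vertices of E₀ joined by the rest of the cycle.
lemma2p22 : ∀ {ℓ : Level} (M : Graph ℓ) → ModelOfT M → Forest (Gtree M)
lemma2p22 M (_ , removable) (k , c , c-injective , c-step , c-close) = through-c₀ (c zero) refl
  where
  open Model M

  c-distinct : ∀ i j → i ≢ j → ¬ _≈_ (Gtree M) (c i) (c j)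
  c-distinct i j i≢j = i≢j ∘ c-injective i j

  through-c₀ : ∀ x₀ → c zero ≡ x₀ → ⊥
  through-c₀ (inj₂ _) c₀≡ =
    no-detour removable c₀≡ (c-step zero) c-close (c-distinct (suc zero) (fromℕ (2 + k)) λ ())
      (path-along (λ i → c (suc i)) λ i → c-step (suc i) , c-distinct (suc (suc i)) zero λ ())
  through-c₀ (inj₁ _) c₀≡ = through-c₁ (c (suc zero)) refl
    where
    through-c₁ : ∀ x₁ → c (suc zero) ≡ x₁ → ⊥
    through-c₁ (inj₁ _) c₁≡ = vertices-not-adjacent c₀≡ c₁≡ (c-step zero)
    through-c₁ (inj₂ _) c₁≡ =
      no-detour removable c₁≡ (c-step (suc zero)) (c-step zero) (c-distinct (suc (suc zero)) zero λ ())
        (path-along (λ i → c (suc (suc i)))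
                    (λ i → c-step (suc (suc i)) , c-distinct (suc (suc (suc i))) (suc zero) λ ())
         ◅◅ return (c-close , c-distinct zero (suc zero) λ ()))
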